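{- Let $\mathcal{R}$ be a commutative ring with unit containing $\mathbb{Q}$, $L$ a set with $|L|\le2$, $\diamond:\mathcal{R}L\times\mathcal{R}L\to\mathcal{R}\langle L\rangle$ a commutative and decomposable $\mathcal R$-bilinear map, and $\alpha,\beta,\gamma\in L$. Suppose that: if $\max\{l(\alpha',\beta')\mid\alpha',\beta'\in L\}=1$, then $F(F(\alpha\diamond\beta)\diamond\gamma)=F(\alpha\diamond F(\beta\diamond\gamma))$; and if $\max\{l(\alpha',\beta')\mid\alpha',\beta'\in L\}>1$, then for all $\alpha',\beta'\in L$ with $l(\alpha',\beta')\ge2$, all $\delta\in L$ and all integers $1\le k'<l(\alpha',\beta')$, $\delta\diamond F(R^{k'}(\alpha'\diamond\beta'))=-\delta F(R^{k'}(\alpha'\diamond\beta'))$. Then $(F(\alpha\diamond\beta)\diamond\gamma)R(\alpha\diamond\beta)=(\alpha\diamond F(\beta\diamond\gamma))R(\beta\diamond\gamma)$.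
   Context: $\mathcal{R}\langle L\rangle$ is the non-commutative polynomial ring over $\mathcal R$ in the letters of $L$, words are monic monomials, $\mathbf1$ the empty word, $\mathcal RL$ the $\mathcal R$-span of $L$. For $\alpha,\beta\in L$, $l(\alpha,\beta)$ is the length of the word occurring in $\alpha\diamond\beta$. $F$ is the $\mathcal R$-linear map sending a word to its first letter and $\mathbf1$ to $\mathbf1$; $R$ sends $\sum_ic_i\alpha_{1,i}\cdots\alpha_{n_i,i}$ to the sum of the distinct words $\alpha_{2,i}\cdots\alpha_{n_i,i}$ (first letter and coefficients removed), with $R(c\alpha)=R(c\mathbf1)=\mathbf1$; $R^k$ is the iterate. $\diamond$ is commutative if $\alpha\diamond\beta=\beta\diamond\alpha$ for all letters, and decomposable if there is a word $w$ with $w=R(\alpha\diamond\beta)$ for all $\alpha,\beta\in L$ with $R(\alpha\diamond\beta)\notin\mathcal RL$. -}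

module Defs where

open import Level using (Level)
open import Algebra.Bundles using (CommutativeRing)
open import Data.Nat using (ℕ; zero; suc; _⊔_; _≤_; _<_)
open import Data.Fin using (Fin) renaming (_≟_ to _≟F_)
open import Data.List using (List; []; _∷_; [_]; _++_; map; concatMap; foldr; length; deduplicate; drop; allFin)
open import Data.List.Properties using (≡-dec)
open import Data.Product using (_×_; _,_; proj₂)
open import Relation.Nullary using (¬_; yes; no)
open import Relation.Binary.PropositionalEquality using (_≡_)

-- Non-commutative polynomials R⟨L⟩ over a commutative ring, L = Fin n,
-- represented as finite formal sums (lists of coefficient/word terms),
-- compared by their coefficient functions.
module Poly {c ℓ : Level} (CR : CommutativeRing c ℓ) (n : ℕ) where
  open CommutativeRing CR

  Letter : Set
  Letter = Fin n

  Word : Set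
  Word = List Letter

  Poly : Set c
  Poly = List (Carrier × Word)

  word : Word → Poly
  word w = [ (1# , w) ]

  letter : Letter → Poly
  letter a = word [ a ]

  _⊕_ : Poly → Poly → Poly
  p ⊕ q = p ++ q

  scale : Carrier → Poly → Poly
  scale r = map (λ { (d , w) → (r * d , w) })

  neg : Poly → Poly
  neg = scale (- 1#)

  _⊗_ : Poly → Poly → Poly
  p ⊗ q = concatMap (λ { (d , v) → map (λ { (e , w) → (d * e , v ++ w) }) q }) p

  coeff : Poly → Word → Carrier
  coeff [] w = 0#
  coeff ((d , v) ∷ p) w with ≡-dec _≟F_ v w
  ... | yes _ = d + coeff p w
  ... | no  _ = coeff p w

  _≃_ : Poly → Poly → Set ℓ
  p ≃ q = ∀ w → coeff p w ≈ coeff q w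

  InRL : Poly → Set ℓ
  InRL p = ∀ w → ¬ (length w ≡ 1) → coeff p w ≈ 0#

  F : Poly → Poly
  F = map λ { (d , []) → (d , []) ; (d , a ∷ _) → (d , [ a ]) }

  -- R : Σ c_i α_{1,i}⋯α_{n_i,i} ↦ sum of the distinct words α_{2,i}⋯α_{n_i,i}
  -- (first letter and coefficients removed; R(cα) = R(c𝟏) = 𝟏)
  Rop : Poly → Poly
  Rop p = map (λ w → (1# , w)) (deduplicate (≡-dec _≟F_) (map (λ t → drop 1 (proj₂ t)) p))

  Rpow : ℕ → Poly → Poly
  Rpow zero p = p
  Rpow (suc k) p = Rop (Rpow k p)

  -- A bilinear map ◇ on letters whose values are monomials α◇β = coef α β · wd α β.
  module Diamond (coef : Letter → Letter → Carrier) (wd : Letter → Letter → Word) where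

    _◇_ : Letter → Letter → Poly
    a ◇ b = [ (coef a b , wd a b) ]

    -- R-bilinear extension of ◇ to R L × R L (only letter terms occur in R L)
    _◇ᴾ_ : Poly → Poly → Poly
    p ◇ᴾ q = concatMap (λ { (d , v) → concatMap (λ { (e , w) → ext d v e w }) q }) p
      where
      ext : Carrier → Word → Carrier → Word → Poly
      ext d (a ∷ []) e (b ∷ []) = scale (d * e) (a ◇ b)
      ext _ _ _ _ = []

    l : Letter → Letter → ℕ
    l a b = length (wd a b)

    lmax : ℕ
    lmax = foldr (λ a m → foldr (λ b m' → l a b ⊔ m') m (allFin n)) 0 (allFin n)

    Commutative : Set ℓ
    Commutative = ∀ a b → (a ◇ b) ≃ (b ◇ a)

    Decomposable : Set ℓ
    Decomposable = Data.Product.Σ Word λ w → ∀ a b → ¬ InRL (Rop (a ◇ b)) → word w ≃ Rop (a ◇ b)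

-- Every value α ◇ β is a single monomial, so both sides of the identity are monomials
-- and it suffices to compare their words and coefficients.  If all words α ◇ β are
-- letters, the identity is the hypothesis F(F(α◇β)◇γ) = F(α◇F(β◇γ)) itself.  Otherwise
-- some word has a second letter u, and the second hypothesis says that every non-head
-- letter z of every word satisfies δ ◇ z = -δz; by commutativity two such letters z, z'
-- give z z' = z' z, so all of them equal u: every word is a letter followed by a power
-- of u.  The identity then holds whenever α or γ is u (the u's just shift along), and
-- whenever α = γ (by commutativity); with at most two letters one of these always applies.
module Submission where

open import Defs
open import Level using (Level)
open import Algebra.Bundles using (CommutativeRing)
open import Algebra.Morphism.Structures using (IsRingMonomorphism)
open import Data.Nat using (ℕ; _≤_; _<_)
open import Data.Fin using (Fin)
open import Data.List using (length; [])
open import Data.Rational using (ℚ)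
open import Data.Rational.Base using (+-*-rawRing)
open import Relation.Nullary using (¬_)
open import Relation.Binary.PropositionalEquality using (_≡_)

open import Data.Nat using (zero; suc; _⊔_; s≤s; z≤n)
open import Data.Nat.Properties using (≤-refl; ≤-trans; m≤m⊔n; m≤n⊔m; ⊔-sel; n≮0)
open import Data.Fin using () renaming (zero to fzero; suc to fsuc; _≟_ to _≟F_)
open import Data.List using (List; _∷_; [_]; _++_; foldr; allFin; drop)
open import Data.List.Properties using (≡-dec; ++-identityʳ; ∷-injectiveˡ)
open import Data.List.Membership.Propositional using (_∈_)
open import Data.List.Membership.Propositional.Properties using (∈-allFin)
open import Data.List.Relation.Unary.Any using (here; there)
open import Data.List.Relation.Unary.All as All using (All; []; _∷_)
open import Data.Product using (∃₂; ∃-syntax; _×_; _,_; proj₁; proj₂)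
open import Data.Sum using (_⊎_; inj₁; inj₂; [_,_]′)
open import Data.Empty using (⊥-elim)
open import Relation.Nullary using (yes; no)
open import Relation.Binary.Bundles using (Setoid)
open import Relation.Binary.PropositionalEquality
  using (refl; sym; trans; cong; cong₂; subst; _≢_; module ≡-Reasoning)
import Relation.Binary.Reasoning.Setoid as SetoidReasoning

module _ {a} {A : Set a} where

  foldr-∈ : (g : A → ℕ → ℕ) (P : ℕ → Set) → (∀ y {k} → P k → P (g y k)) →
            ∀ {x} → (∀ k → P (g x k)) → ∀ e {xs} → x ∈ xs → P (foldr g e xs)
  foldr-∈ g P mono Pgx e          (here refl)  = Pgx _
  foldr-∈ g P mono Pgx e {y ∷ _}  (there x∈xs) = mono y (foldr-∈ g P mono Pgx e x∈xs)

  foldr-invariant : (g : A → ℕ → ℕ) (P : ℕ → Set) → (∀ y {k} → P k → P (g y k)) →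
                    ∀ {e} → P e → ∀ xs → P (foldr g e xs)
  foldr-invariant g P step Pe []       = Pe
  foldr-invariant g P step Pe (y ∷ xs) = step y (foldr-invariant g P step Pe xs)

  All-from-drop : ∀ {p} {P : A → Set p} {xs : List A} →
                  (∀ k {z zs} → drop k xs ≡ z ∷ zs → P z) → All P xs
  All-from-drop {xs = []}     _ = []
  All-from-drop {xs = x ∷ xs} h = h 0 refl ∷ All-from-drop (λ k → h (suc k))

  drop-1-drop : ∀ k (xs : List A) → drop 1 (drop k xs) ≡ drop (suc k) xs
  drop-1-drop zero    xs       = refl
  drop-1-drop (suc k) []       = refl
  drop-1-drop (suc k) (_ ∷ xs) = drop-1-drop k xs

  drop≡∷⇒< : ∀ k {xs : List A} {z zs} → drop k xs ≡ z ∷ zs → k < length xs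
  drop≡∷⇒< zero    {_ ∷ _}  _ = s≤s z≤n
  drop≡∷⇒< (suc k) {_ ∷ xs} e = s≤s (drop≡∷⇒< k e)

  All≡-∷ʳ : ∀ {u : A} {xs} → All (_≡ u) xs → xs ++ [ u ] ≡ u ∷ xs
  All≡-∷ʳ []           = refl
  All≡-∷ʳ (refl ∷ all) = cong (_ ∷_) (All≡-∷ʳ all)

  ≤1-nonempty⇒singleton : (xs : List A) → length xs ≤ 1 → xs ≢ [] → ∃[ x ] xs ≡ [ x ]
  ≤1-nonempty⇒singleton []           _             xs≢[] = ⊥-elim (xs≢[] refl)
  ≤1-nonempty⇒singleton (x ∷ [])     _             _     = x , refl
  ≤1-nonempty⇒singleton (_ ∷ _ ∷ _)  (s≤s ())      _

distinct-cover : ∀ {n} → n ≤ 2 → {x y : Fin n} → x ≢ y → ∀ u → x ≡ u ⊎ y ≡ u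
distinct-cover _ {fzero}      {fzero}      x≢y _ = ⊥-elim (x≢y refl)
distinct-cover _ {fsuc fzero} {fsuc fzero} x≢y _ = ⊥-elim (x≢y refl)
distinct-cover _ {fzero}      {fsuc fzero} _ fzero        = inj₁ refl
distinct-cover _ {fzero}      {fsuc fzero} _ (fsuc fzero) = inj₂ refl
distinct-cover _ {fsuc fzero} {fzero}      _ fzero        = inj₂ refl
distinct-cover _ {fsuc fzero} {fzero}      _ (fsuc fzero) = inj₁ refl
distinct-cover {suc (suc (suc _))} (s≤s (s≤s ()))

module Monomials {c ℓ : Level} (CR : CommutativeRing c ℓ) (n : ℕ) where
  open CommutativeRing CR renaming (refl to ≈-refl; sym to ≈-sym; trans to ≈-trans)
  open Poly CR n

  monomial : Carrier → Word → Poly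
  monomial d w = [ (d , w) ]

  ≃-setoid : Setoid c ℓ
  ≃-setoid = record
    { Carrier       = Poly
    ; _≈_           = _≃_
    ; isEquivalence = record
      { refl  = λ _ → ≈-refl
      ; sym   = λ p≃q w → ≈-sym (p≃q w)
      ; trans = λ p≃q q≃r w → ≈-trans (p≃q w) (q≃r w)
      }
    }

  coeff-monomial-≡ : ∀ d w → coeff (monomial d w) w ≈ d
  coeff-monomial-≡ d w with ≡-dec _≟F_ w w
  ... | yes _   = +-identityʳ d
  ... | no w≢w  = ⊥-elim (w≢w refl)

  coeff-monomial-≢ : ∀ d {v w} → v ≢ w → coeff (monomial d v) w ≈ 0#
  coeff-monomial-≢ d {v} {w} v≢w with ≡-dec _≟F_ v w
  ... | yes v≡w = ⊥-elim (v≢w v≡w)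
  ... | no _    = ≈-refl

  monomial-congˡ : ∀ {d d′} v → d ≈ d′ → monomial d v ≃ monomial d′ v
  monomial-congˡ v d≈d′ w with ≡-dec _≟F_ v w
  ... | yes _ = +-cong d≈d′ ≈-refl
  ... | no _  = ≈-refl

  monomial-injective : ∀ {d d′ v v′} → monomial d v ≃ monomial d′ v′ → ¬ d ≈ 0# →
                       v ≡ v′ × d ≈ d′
  monomial-injective {d} {d′} {v} {v′} eq d≉0 with ≡-dec _≟F_ v′ v
  ... | yes refl =
    refl , ≈-trans (≈-sym (coeff-monomial-≡ d v)) (≈-trans (eq v) (coeff-monomial-≡ d′ v))
  ... | no v′≢v  = ⊥-elim (d≉0 (≈-trans (≈-sym (coeff-monomial-≡ d v))
                                      (≈-trans (eq v) (coeff-monomial-≢ d′ v′≢v))))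

  F-monomial-letter : ∀ d {w} → length w ≡ 1 → F (monomial d w) ≡ monomial d w
  F-monomial-letter d {_ ∷ []} _ = refl

  Rpow-monomial : ∀ k d w → Rpow (suc k) (monomial d w) ≡ word (drop (suc k) w)
  Rpow-monomial zero    d w = refl
  Rpow-monomial (suc k) d w =
    trans (cong Rop (Rpow-monomial k d w)) (cong word (drop-1-drop (suc k) w))

module HeadAssociativity {c ℓ : Level} (CR : CommutativeRing c ℓ) (n : ℕ)
  (coef : Fin n → Fin n → CommutativeRing.Carrier CR)
  (wd : Fin n → Fin n → List (Fin n))
  (coef≉0 : ∀ a b → ¬ (CommutativeRing._≈_ CR (coef a b) (CommutativeRing.0# CR)))
  (wd≢[] : ∀ a b → wd a b ≢ []) where

  open CommutativeRing CR renaming (refl to ≈-refl; sym to ≈-sym; trans to ≈-trans)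
  open Poly CR n
  open Diamond coef wd
  open Monomials CR n

  HeadAssociative : Letter → Letter → Letter → Set ℓ
  HeadAssociative α β γ =
    ((F (α ◇ β) ◇ᴾ letter γ) ⊗ Rop (α ◇ β)) ≃ ((letter α ◇ᴾ F (β ◇ γ)) ⊗ Rop (β ◇ γ))

  ConcatNeg : Letter → Set ℓ
  ConcatNeg z = ∀ δ → (letter δ ◇ᴾ letter z) ≃ neg (letter δ ⊗ letter z)

  NonHeadLettersConcatNeg : Set ℓ
  NonHeadLettersConcatNeg = ∀ α′ β′ → 2 ≤ l α′ β′ → ∀ (δ : Letter) (k′ : ℕ) → 1 ≤ k′ →
    k′ < l α′ β′ → (letter δ ◇ᴾ F (Rpow k′ (α′ ◇ β′))) ≃ neg (letter δ ⊗ F (Rpow k′ (α′ ◇ β′)))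

  uncons : ∀ x y → ∃₂ λ h t → wd x y ≡ h ∷ t
  uncons x y with wd x y | wd≢[] x y
  ... | []    | wd≢[]′ = ⊥-elim (wd≢[]′ refl)
  ... | h ∷ t | _      = h , t , refl

  F◇-letter : ∀ {α β a t} γ → wd α β ≡ a ∷ t →
              F (α ◇ β) ◇ᴾ letter γ ≡ monomial ((coef α β * 1#) * coef a γ) (wd a γ)
  F◇-letter {α} {β} γ e = cong (λ w → F (monomial (coef α β) w) ◇ᴾ letter γ) e

  letter-◇F : ∀ α {β γ b t} → wd β γ ≡ b ∷ t →
              letter α ◇ᴾ F (β ◇ γ) ≡ monomial ((1# * coef β γ) * coef α b) (wd α b)
  letter-◇F α {β} {γ} e = cong (λ w → letter α ◇ᴾ F (monomial (coef β γ) w)) e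

  Rop-◇ : ∀ {α β a t} → wd α β ≡ a ∷ t → Rop (α ◇ β) ≡ word t
  Rop-◇ {α} {β} e = cong (λ w → Rop (monomial (coef α β) w)) e

  lhs-monomial : ∀ {α β a t} γ → wd α β ≡ a ∷ t →
    ((F (α ◇ β) ◇ᴾ letter γ) ⊗ Rop (α ◇ β)) ≃ monomial (coef α β * coef a γ) (wd a γ ++ t)
  lhs-monomial {α} {β} {a} {t} γ e = begin
    (F (α ◇ β) ◇ᴾ letter γ) ⊗ Rop (α ◇ β)
      ≡⟨ cong₂ _⊗_ (F◇-letter γ e) (Rop-◇ e) ⟩
    monomial ((coef α β * 1#) * coef a γ) (wd a γ) ⊗ word t
      ≈⟨ monomial-congˡ (wd a γ ++ t) (≈-trans (*-identityʳ _) (*-congʳ (*-identityʳ _))) ⟩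
    monomial (coef α β * coef a γ) (wd a γ ++ t)
      ∎
    where open SetoidReasoning ≃-setoid

  rhs-monomial : ∀ α {β γ b t} → wd β γ ≡ b ∷ t →
    ((letter α ◇ᴾ F (β ◇ γ)) ⊗ Rop (β ◇ γ)) ≃ monomial (coef β γ * coef α b) (wd α b ++ t)
  rhs-monomial α {β} {γ} {b} {t} e = begin
    (letter α ◇ᴾ F (β ◇ γ)) ⊗ Rop (β ◇ γ)
      ≡⟨ cong₂ _⊗_ (letter-◇F α e) (Rop-◇ e) ⟩
    monomial ((1# * coef β γ) * coef α b) (wd α b) ⊗ word t
      ≈⟨ monomial-congˡ (wd α b ++ t) (≈-trans (*-identityʳ _) (*-congʳ (*-identityˡ _))) ⟩
    monomial (coef β γ * coef α b) (wd α b ++ t)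
      ∎
    where open SetoidReasoning ≃-setoid

  head-associative-criterion : ∀ α β γ {a b t₁ t₂} → wd α β ≡ a ∷ t₁ → wd β γ ≡ b ∷ t₂ →
    coef α β * coef a γ ≈ coef β γ * coef α b → wd a γ ++ t₁ ≡ wd α b ++ t₂ →
    HeadAssociative α β γ
  head-associative-criterion α β γ {a} {b} {t₁} {t₂} e₁ e₂ coef-eq wd-eq = begin
    (F (α ◇ β) ◇ᴾ letter γ) ⊗ Rop (α ◇ β)          ≈⟨ lhs-monomial γ e₁ ⟩
    monomial (coef α β * coef a γ) (wd a γ ++ t₁)  ≈⟨ monomial-congˡ (wd a γ ++ t₁) coef-eq ⟩
    monomial (coef β γ * coef α b) (wd a γ ++ t₁)  ≡⟨ cong (monomial _) wd-eq ⟩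
    monomial (coef β γ * coef α b) (wd α b ++ t₂)  ≈⟨ rhs-monomial α e₂ ⟨
    (letter α ◇ᴾ F (β ◇ γ)) ⊗ Rop (β ◇ γ)          ∎
    where open SetoidReasoning ≃-setoid

  head-associative-letters : (∀ x y → ∃[ h ] wd x y ≡ [ h ]) → ∀ α β γ →
    F (F (α ◇ β) ◇ᴾ letter γ) ≃ F (letter α ◇ᴾ F (β ◇ γ)) → HeadAssociative α β γ
  head-associative-letters letters α β γ hyp with letters α β | letters β γ
  ... | a , e₁ | b , e₂ = begin
    (F (α ◇ β) ◇ᴾ letter γ) ⊗ Rop (α ◇ β)
      ≈⟨ lhs-monomial γ e₁ ⟩
    monomial (coef α β * coef a γ) (wd a γ ++ [])
      ≡⟨ cong (monomial _) (++-identityʳ (wd a γ)) ⟩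
    monomial (coef α β * coef a γ) (wd a γ)
      ≈⟨ monomial-congˡ (wd a γ) (≈-sym (*-congʳ (*-identityʳ _))) ⟩
    monomial ((coef α β * 1#) * coef a γ) (wd a γ)
      ≡⟨ F-monomial-letter _ (cong length (proj₂ (letters a γ))) ⟨
    F (monomial ((coef α β * 1#) * coef a γ) (wd a γ))
      ≡⟨ cong F (F◇-letter γ e₁) ⟨
    F (F (α ◇ β) ◇ᴾ letter γ)
      ≈⟨ hyp ⟩
    F (letter α ◇ᴾ F (β ◇ γ))
      ≡⟨ cong F (letter-◇F α e₂) ⟩
    F (monomial ((1# * coef β γ) * coef α b) (wd α b))
      ≡⟨ F-monomial-letter _ (cong length (proj₂ (letters α b))) ⟩
    monomial ((1# * coef β γ) * coef α b) (wd α b)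
      ≈⟨ monomial-congˡ (wd α b) (*-congʳ (*-identityˡ _)) ⟩
    monomial (coef β γ * coef α b) (wd α b)
      ≡⟨ cong (monomial _) (++-identityʳ (wd α b)) ⟨
    monomial (coef β γ * coef α b) (wd α b ++ [])
      ≈⟨ rhs-monomial α e₂ ⟨
    (letter α ◇ᴾ F (β ◇ γ)) ⊗ Rop (β ◇ γ)
      ∎
    where open SetoidReasoning ≃-setoid

  row-max : Letter → ℕ → ℕ
  row-max a k = foldr (λ b k′ → l a b ⊔ k′) k (allFin n)

  row-max-inflationary : ∀ a {k} → k ≤ row-max a k
  row-max-inflationary a {k} =
    foldr-invariant _ (k ≤_) (λ b p → ≤-trans p (m≤n⊔m (l a b) _)) ≤-refl (allFin n)

  row-max-attained : ∀ a k → row-max a k ≡ k ⊎ ∃[ b ] row-max a k ≡ l a b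
  row-max-attained a k =
    foldr-invariant _ (λ m → m ≡ k ⊎ ∃[ b ] m ≡ l a b) select (inj₁ refl) (allFin n)
    where
    select : ∀ b {m} → m ≡ k ⊎ ∃[ b′ ] m ≡ l a b′ → l a b ⊔ m ≡ k ⊎ ∃[ b′ ] l a b ⊔ m ≡ l a b′
    select b {m} prev with ⊔-sel (l a b) m | prev
    ... | inj₁ e | _              = inj₂ (b , e)
    ... | inj₂ e | inj₁ m≡k       = inj₁ (trans e m≡k)
    ... | inj₂ e | inj₂ (b′ , e′) = inj₂ (b′ , trans e e′)

  l≤lmax : ∀ a b → l a b ≤ lmax
  l≤lmax a b = foldr-∈ row-max (l a b ≤_) (λ y p → ≤-trans p (row-max-inflationary y))
                 (λ _ → l≤row-max) 0 (∈-allFin a)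
    where
    l≤row-max : ∀ {k} → l a b ≤ row-max a k
    l≤row-max {k} = foldr-∈ _ (l a b ≤_) (λ y p → ≤-trans p (m≤n⊔m (l a y) _))
                      (m≤m⊔n (l a b)) k (∈-allFin b)

  lmax-attained : lmax ≡ 0 ⊎ ∃₂ λ a b → lmax ≡ l a b
  lmax-attained = foldr-invariant row-max Attained step (inj₁ refl) (allFin n)
    where
    Attained : ℕ → Set
    Attained k = k ≡ 0 ⊎ ∃₂ λ a b → k ≡ l a b
    step : ∀ a {k} → Attained k → Attained (row-max a k)
    step a {k} att with row-max-attained a k
    ... | inj₁ e       = subst Attained (sym e) att
    ... | inj₂ (b , e) = inj₂ (a , b , e)

  LongWord : Set
  LongWord = ∃₂ λ a b → ∃₂ λ x u → ∃[ t ] wd a b ≡ x ∷ u ∷ t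

  lmax-dichotomy : Letter → lmax ≡ 1 ⊎ LongWord
  lmax-dichotomy α with lmax-attained | uncons α α
  ... | inj₁ lmax≡0 | h , t , e =
    ⊥-elim (n≮0 (subst (_≤ 0) (cong length e) (subst (l α α ≤_) lmax≡0 (l≤lmax α α))))
  ... | inj₂ (a , b , e) | _ with wd a b in eq
  ...   | []        = ⊥-elim (wd≢[] a b eq)
  ...   | _ ∷ []    = inj₁ e
  ...   | x ∷ u ∷ t = inj₂ (a , b , x , u , t , eq)

  lmax≡1⇒letters : lmax ≡ 1 → ∀ x y → ∃[ h ] wd x y ≡ [ h ]
  lmax≡1⇒letters lmax≡1 x y =
    ≤1-nonempty⇒singleton (wd x y) (subst (l x y ≤_) lmax≡1 (l≤lmax x y)) (wd≢[] x y)

  LongWord⇒1<lmax : LongWord → 1 < lmax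
  LongWord⇒1<lmax (a , b , _ , _ , _ , e) =
    ≤-trans (subst (2 ≤_) (cong length (sym e)) (s≤s (s≤s z≤n))) (l≤lmax a b)

  ConcatNeg⇒ : ∀ {z} → ConcatNeg z → ∀ δ → wd δ z ≡ δ ∷ z ∷ [] × coef δ z ≈ - 1#
  ConcatNeg⇒ {z} z-neg δ = proj₁ injective , (begin
    coef δ z               ≈⟨ 1·1·c≈c ⟨
    (1# * 1#) * coef δ z   ≈⟨ proj₂ injective ⟩
    - 1# * (1# * 1#)       ≈⟨ *-congˡ (*-identityʳ 1#) ⟩
    - 1# * 1#              ≈⟨ *-identityʳ (- 1#) ⟩
    - 1#                   ∎)
    where
    open SetoidReasoning setoid
    1·1·c≈c : (1# * 1#) * coef δ z ≈ coef δ z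
    1·1·c≈c = ≈-trans (*-congʳ (*-identityˡ 1#)) (*-identityˡ _)
    injective : wd δ z ≡ δ ∷ z ∷ [] × (1# * 1#) * coef δ z ≈ - 1# * (1# * 1#)
    injective = monomial-injective (z-neg δ) (λ c≈0 → coef≉0 δ z (≈-trans (≈-sym 1·1·c≈c) c≈0))

  tail-ConcatNeg : NonHeadLettersConcatNeg → ∀ {x y h t} → wd x y ≡ h ∷ t → All ConcatNeg t
  tail-ConcatNeg nonHead {x} {y} {h} {t} e = All-from-drop λ k {z} {zs} e′ δ →
    subst (λ p → (letter δ ◇ᴾ F p) ≃ neg (letter δ ⊗ F p)) (Rpow≡ k e′)
      (nonHead x y (≤-trans (s≤s (s≤s z≤n)) (k<l k e′)) δ (suc k) (s≤s z≤n) (k<l k e′))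
    where
    k<l : ∀ k {z zs} → drop k t ≡ z ∷ zs → suc k < l x y
    k<l k e′ = subst (suc k <_) (cong length (sym e)) (s≤s (drop≡∷⇒< k e′))
    Rpow≡ : ∀ k {z zs} → drop k t ≡ z ∷ zs → Rpow (suc k) (x ◇ y) ≡ word (z ∷ zs)
    Rpow≡ k e′ =
      trans (Rpow-monomial k (coef x y) (wd x y)) (cong word (trans (cong (drop (suc k)) e) e′))

  module _ (comm : Commutative) where

    ◇-comm : ∀ x y → wd x y ≡ wd y x × coef x y ≈ coef y x
    ◇-comm x y = monomial-injective {coef x y} {coef y x} {wd x y} {wd y x} (comm x y) (coef≉0 x y)

    wd-comm : ∀ x y → wd x y ≡ wd y x
    wd-comm x y = proj₁ (◇-comm x y)

    coef-comm : ∀ x y → coef x y ≈ coef y x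
    coef-comm x y = proj₂ (◇-comm x y)

    ConcatNeg-unique : ∀ {z z′} → ConcatNeg z → ConcatNeg z′ → z ≡ z′
    ConcatNeg-unique {z} {z′} z-neg z′-neg = ∷-injectiveˡ (begin
      z ∷ z′ ∷ []  ≡⟨ proj₁ (ConcatNeg⇒ z′-neg z) ⟨
      wd z z′      ≡⟨ wd-comm z z′ ⟩
      wd z′ z      ≡⟨ proj₁ (ConcatNeg⇒ z-neg z′) ⟩
      z′ ∷ z ∷ []  ∎)
      where open ≡-Reasoning

    head-associative-diagonal : ∀ α β → HeadAssociative α β α
    head-associative-diagonal α β with uncons α β
    ... | a , t , e = head-associative-criterion α β α e (trans (wd-comm β α) e)
                        (*-cong (coef-comm α β) (coef-comm a α)) (cong (_++ t) (wd-comm a α))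

    module _ {u} (u-neg : ConcatNeg u)
             (tails-u : ∀ {x y h t} → wd x y ≡ h ∷ t → All (_≡ u) t) where

      wd-◇u : ∀ δ → wd δ u ≡ δ ∷ u ∷ []
      wd-◇u δ = proj₁ (ConcatNeg⇒ u-neg δ)

      wd-u◇ : ∀ δ → wd u δ ≡ δ ∷ u ∷ []
      wd-u◇ δ = trans (wd-comm u δ) (wd-◇u δ)

      coef-◇u : ∀ δ → coef δ u ≈ - 1#
      coef-◇u δ = proj₂ (ConcatNeg⇒ u-neg δ)

      coef-u◇ : ∀ δ → coef u δ ≈ - 1#
      coef-u◇ δ = ≈-trans (coef-comm u δ) (coef-◇u δ)

      head-associative-left-u : ∀ β γ → HeadAssociative u β γ
      head-associative-left-u β γ with uncons β γ
      ... | b , t , e = head-associative-criterion u β γ (wd-u◇ β) e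
        (≈-trans (*-congʳ (≈-trans (coef-u◇ β) (≈-sym (coef-u◇ b)))) (*-comm _ _))
        (begin
          wd β γ ++ [ u ]  ≡⟨ cong (_++ [ u ]) e ⟩
          b ∷ t ++ [ u ]   ≡⟨ cong (b ∷_) (All≡-∷ʳ (tails-u e)) ⟩
          b ∷ u ∷ t        ≡⟨ cong (_++ t) (wd-u◇ b) ⟨
          wd u b ++ t      ∎)
        where open ≡-Reasoning

      head-associative-right-u : ∀ α β → HeadAssociative α β u
      head-associative-right-u α β with uncons α β
      ... | a , t , e = head-associative-criterion α β u e (wd-◇u β)
        (≈-trans (*-congˡ (≈-trans (coef-◇u a) (≈-sym (coef-◇u β)))) (*-comm _ _))
        (begin
          wd a u ++ t      ≡⟨ cong (_++ t) (wd-◇u a) ⟩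
          a ∷ u ∷ t        ≡⟨ cong (a ∷_) (All≡-∷ʳ (tails-u e)) ⟨
          a ∷ t ++ [ u ]   ≡⟨ cong (_++ [ u ]) e ⟨
          wd α β ++ [ u ]  ∎)
        where open ≡-Reasoning

      head-associative-n≤2 : n ≤ 2 → ∀ α β γ → HeadAssociative α β γ
      head-associative-n≤2 n≤2 α β γ with α ≟F γ
      ... | yes refl = head-associative-diagonal α β
      ... | no α≢γ with distinct-cover n≤2 α≢γ u
      ...   | inj₁ refl = head-associative-left-u β γ
      ...   | inj₂ refl = head-associative-right-u α β

    head-associative-long : n ≤ 2 → NonHeadLettersConcatNeg → LongWord →
                            ∀ α β γ → HeadAssociative α β γ
    head-associative-long n≤2 nonHead (_ , _ , _ , u , _ , e) =
      head-associative-n≤2 u-neg tails-u n≤2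
      where
      u-neg : ConcatNeg u
      u-neg = All.head (tail-ConcatNeg nonHead e)
      tails-u : ∀ {x y h t} → wd x y ≡ h ∷ t → All (_≡ u) t
      tails-u e′ = All.map (λ z-neg → ConcatNeg-unique z-neg u-neg) (tail-ConcatNeg nonHead e′)

lemma3p10 : ∀ {c ℓ : Level} (CR : CommutativeRing c ℓ)
    → (ι : ℚ → CommutativeRing.Carrier CR)
    → IsRingMonomorphism +-*-rawRing (CommutativeRing.rawRing CR) ι
    → (n : ℕ) → n ≤ 2
    → (coef : Fin n → Fin n → CommutativeRing.Carrier CR)
    → (wd : Fin n → Fin n → Data.List.List (Fin n))
    → (∀ a b → ¬ (CommutativeRing._≈_ CR (coef a b) (CommutativeRing.0# CR)))
    → (∀ a b → ¬ (wd a b ≡ []))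
    → let open Poly CR n in
      let open Diamond coef wd in
      Commutative → Decomposable
    → (α β γ : Fin n)
    → (lmax ≡ 1 → F (F (α ◇ β) ◇ᴾ letter γ) ≃ F (letter α ◇ᴾ F (β ◇ γ)))
    → (1 < lmax → ∀ α' β' → 2 ≤ l α' β' → ∀ (δ : Fin n) (k' : ℕ) → 1 ≤ k' → k' < l α' β'
         → (letter δ ◇ᴾ F (Rpow k' (α' ◇ β'))) ≃ neg (letter δ ⊗ F (Rpow k' (α' ◇ β'))))
    → ((F (α ◇ β) ◇ᴾ letter γ) ⊗ Rop (α ◇ β)) ≃ ((letter α ◇ᴾ F (β ◇ γ)) ⊗ Rop (β ◇ γ))
lemma3p10 CR _ _ n n≤2 coef wd coef≉0 wd≢[] comm _ α β γ hyp₁ hyp₂ =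
  [ (λ lmax≡1 → head-associative-letters (lmax≡1⇒letters lmax≡1) α β γ (hyp₁ lmax≡1))
  , (λ long → head-associative-long comm n≤2 (hyp₂ (LongWord⇒1<lmax long)) long α β γ)
  ]′ (lmax-dichotomy α)
  where open HeadAssociativity CR n coef wd coef≉0 wd≢[]
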